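{- Let $0<k\le n$ be integers and consider Moore's game $\mathrm{NIM}_{n,k}$. If $x=(x_1,\dots,x_n)\in\mathbb{Z}_+^n$ is a P-position of $\mathrm{NIM}_{n,k}$, then $\mathcal{R}(x)=2S(x)/(k+1)$, where $S(x)=\sum_{i=1}^n x_i$.
   Context: Moore's game $\mathrm{NIM}_{n,k}$ (for integers $0<k\le n$): positions are vectors $x=(x_1,\dots,x_n)\in\mathbb{Z}_+^n$ (sizes of $n$ piles of stones). Two players alternate; a move chooses any $\ell$ nonempty piles with $1\le \ell\le k$ and strictly reduces each of them (by arbitrary amounts). A player who cannot move loses (normal play). Remoteness function (Smith): for an acyclic game in which every position reaches only finitely many positions, $\mathcal{R}(x)=0$ if $x$ is terminal; otherwise, if some move $x\to y$ has $\mathcal{R}(y)$ even, $\mathcal{R}(x)=1+\min\{\mathcal{R}(y): x\to y,\ \mathcal{R}(y)\text{ even}\}$, and else $\mathcal{R}(x)=1+\max\{\mathcal{R}(y): x\to y\}$. P-positions are exactly the positions with $\mathcal{R}$ even (the player to move loses); N-positions are those with $\mathcal{R}$ odd. -}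

module Defs where

open import Data.Nat using (ℕ; zero; suc; _+_; _≤ᵇ_; _<ᵇ_; _⊔_; _⊓_)
open import Data.Bool using (Bool; true; false; _∧_; if_then_else_)
open import Data.List using (List; []; _∷_; map; filter; concatMap; upTo)
open import Data.Vec using (Vec; []; _∷_)
open import Data.Unit using (⊤)
open import Data.Empty using (⊥)
open import Relation.Nullary.Decidable using (Dec)
open import Data.Bool using (T; T?)

evenᵇ : ℕ → Bool
evenᵇ zero = true
evenᵇ (suc n) with evenᵇ n
... | true = false
... | false = true

Even : ℕ → Set
Even n = T (evenᵇ n)

S : ∀ {n} → Vec ℕ n → ℕ
S [] = 0
S (a ∷ x) = a + S x

below : ∀ {n} → Vec ℕ n → List (Vec ℕ n)
below [] = [] ∷ []
below (a ∷ x) = concatMap (λ b → map (b ∷_) (below x)) (upTo (suc a))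

changed : ∀ {n} → Vec ℕ n → Vec ℕ n → ℕ
changed [] [] = 0
changed (a ∷ x) (b ∷ y) = (if b <ᵇ a then 1 else 0) + changed x y

-- y is a legal NIM_{n,k} move from x (given y ≤ x componentwise):
-- between 1 and k piles are strictly reduced
isMove : ∀ {n} → ℕ → Vec ℕ n → Vec ℕ n → Bool
isMove k x y = (1 ≤ᵇ changed x y) ∧ (changed x y ≤ᵇ k)

moves : ∀ {n} → ℕ → Vec ℕ n → List (Vec ℕ n)
moves k x = filter (λ y → T? (isMove k x y)) (below x)

evensOf : List ℕ → List ℕ
evensOf = filter (λ r → T? (evenᵇ r))

minList : ℕ → List ℕ → ℕ
minList d [] = d
minList d (r ∷ rs) = minList (d ⊓ r) rs

maxList : List ℕ → ℕ
maxList [] = 0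
maxList (r ∷ rs) = r ⊔ maxList rs

-- Smith's remoteness with fuel; each move lowers S by at least 1,
-- so fuel S x suffices (with fuel 0, i.e. S x = 0, x is terminal).
remF : ∀ {n} → ℕ → ℕ → Vec ℕ n → ℕ
remF k zero x = 0
remF k (suc f) x with map (remF k f) (moves k x)
... | [] = 0
... | (r ∷ rs) with evensOf (r ∷ rs)
...   | (e ∷ es) = suc (minList e es)
...   | [] = suc (maxList (r ∷ rs))

remoteness : ∀ {n} → ℕ → Vec ℕ n → ℕ
remoteness k x = remF k (S x) x

IsP : ∀ {n} → ℕ → Vec ℕ n → Set
IsP k x = Even (remoteness k x)

{-# OPTIONS --safe #-}

-- Moore's theorem: x is a P-position iff it is balanced, i.e. for every binary digit the
-- number of piles having that digit 1 is divisible by k + 1.  If two balanced positions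
-- y ≤ x differ in at most k piles, then so do their halves, which are balanced too; by
-- induction the halves agree, so the numbers of odd piles differ by the number of changed
-- piles, a multiple of k + 1 below k + 1: no move joins two balanced positions.  From any
-- position a balanced one is reached in one move by balancing the halves first and then
-- adjusting the lowest digits of at most k piles altogether.
--
-- Remoteness: a move from a balanced x followed by a return to a balanced z changes at least
-- k + 1 piles, so S z ≤ S x − (k + 1).  Conversely the loser may remove a single stone from
-- the pile whose lowest digit 1 is lowest; every balanced position reachable afterwards has
-- lost at most k + 1 stones.  By induction R(x) (k + 1) = 2 S(x).
module Submission where

open import Defs
open import Data.Bool using (true; false; if_then_else_; T; T?)
open import Data.Bool.Properties using (T-∧)
open import Data.Empty using (⊥-elim)
open import Data.List using (List; []; _∷_; map; upTo)
open import Data.List.Membership.Propositional using (_∈_; find; lose)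
open import Data.List.Membership.Propositional.Properties
  using (∈-concatMap⁺; ∈-concatMap⁻; ∈-map⁺; ∈-map⁻; ∈-upTo⁺; ∈-upTo⁻; ∈-filter⁺; ∈-filter⁻)
open import Data.List.Properties using (map-cong-local)
open import Data.List.Relation.Unary.All as All using (All; []; _∷_)
open import Data.List.Relation.Unary.Any using (here; there)
open import Data.Nat
open import Data.Nat.Properties
open import Data.Nat.Divisibility using (_∣_; ∣⇒≤; ∣m+n∣m⇒∣n; divides)
open import Data.Nat.DivMod using (_%_; _/_; m≡m%n+[m/n]*n; m%n≤m; m%n<n)
open import Data.Nat.Tactic.RingSolver using (solve-∀)
open import Algebra.Properties.CommutativeSemigroup +-commutativeSemigroup using (interchange)
open import Data.Product using (∃; _×_; _,_; proj₁; proj₂)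
open import Data.Sum using (inj₁; inj₂)
open import Data.Unit using (tt)
open import Data.Vec as Vec using (Vec; []; _∷_)
open import Data.Vec.Properties using (∷-injective)
open import Data.Vec.Relation.Binary.Pointwise.Inductive as Pointwise using (Pointwise; []; _∷_)
open import Function.Base using (_∘_)
open import Function.Bundles using (Equivalence; _⇔_; mk⇔)
open import Induction.WellFounded using (module All)
open import Data.Nat.Induction using (<-wellFounded)
import Relation.Binary.Construct.On as On
open import Relation.Binary.PropositionalEquality
open import Relation.Nullary using (¬_; yes; no; contradiction)

infix 4 _≤ᵥ_

_≤ᵥ_ : ∀ {n} → Vec ℕ n → Vec ℕ n → Set
_≤ᵥ_ = Pointwise _≤_

≤ᵥ-refl : ∀ {n} {x : Vec ℕ n} → x ≤ᵥ x
≤ᵥ-refl = Pointwise.refl ≤-refl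

≤ᵥ-trans : ∀ {n} {x y z : Vec ℕ n} → x ≤ᵥ y → y ≤ᵥ z → x ≤ᵥ z
≤ᵥ-trans = Pointwise.trans ≤-trans

S-induction : ∀ {n ℓ} (P : Vec ℕ n → Set ℓ) →
              (∀ x → (∀ y → S y < S x → P y) → P x) → ∀ x → P x
S-induction P step = All.wfRec (On.wellFounded S <-wellFounded) _ P λ x IH → step x λ y → IH {y}

∈-below⁺ : ∀ {n} {x y : Vec ℕ n} → y ≤ᵥ x → y ∈ below x
∈-below⁺ [] = here refl
∈-below⁺ {x = a ∷ x} {b ∷ y} (b≤a ∷ y≤x) =
  ∈-concatMap⁺ (λ c → map (c ∷_) (below x))
    (lose (∈-upTo⁺ (s≤s b≤a)) (∈-map⁺ (b ∷_) (∈-below⁺ y≤x)))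

∈-below⁻ : ∀ {n} (x y : Vec ℕ n) → y ∈ below x → y ≤ᵥ x
∈-below⁻ [] [] _ = []
∈-below⁻ (a ∷ x) (b ∷ y) y∈
  with c , c∈ , y∈′ ← find (∈-concatMap⁻ (λ c → map (c ∷_) (below x)) {upTo (suc a)} y∈)
  with w , w∈ , refl ← ∈-map⁻ (c ∷_) y∈′
  = ≤-pred (∈-upTo⁻ c∈) ∷ ∈-below⁻ x w w∈

<ᵇ≡true⇒< : ∀ b a → (b <ᵇ a) ≡ true → b < a
<ᵇ≡true⇒< b a eq = <ᵇ⇒< b a (subst T (sym eq) tt)

<ᵇ≡false⇒≥ : ∀ b a → (b <ᵇ a) ≡ false → a ≤ b
<ᵇ≡false⇒≥ b a eq = ≮⇒≥ λ b<a → subst T eq (<⇒<ᵇ b<a)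

changedAt : ℕ → ℕ → ℕ
changedAt a b = if b <ᵇ a then 1 else 0

changedAt-< : ∀ {a b} → b < a → changedAt a b ≡ 1
changedAt-< {a} {b} b<a with b <ᵇ a in eq
... | true  = refl
... | false = contradiction b<a (≤⇒≯ (<ᵇ≡false⇒≥ b a eq))

changedAt-≥ : ∀ {a b} → a ≤ b → changedAt a b ≡ 0
changedAt-≥ {a} {b} a≤b with b <ᵇ a in eq
... | false = refl
... | true  = contradiction (<ᵇ≡true⇒< b a eq) (≤⇒≯ a≤b)

changedAt≤1 : ∀ a b → changedAt a b ≤ 1
changedAt≤1 a b with b <ᵇ a
... | true  = ≤-refl
... | false = z≤n

∈-moves⁻ : ∀ {n} k (x : Vec ℕ n) {y} → y ∈ moves k x →
           y ≤ᵥ x × 1 ≤ changed x y × changed x y ≤ k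
∈-moves⁻ k x {y} y∈ with y∈below , legal ← ∈-filter⁻ (λ y → T? (isMove k x y)) {xs = below x} y∈
  with one , atMostK ← Equivalence.to T-∧ legal
  = ∈-below⁻ x y y∈below , ≤ᵇ⇒≤ 1 _ one , ≤ᵇ⇒≤ _ k atMostK

∈-moves⁺ : ∀ {n} k {x y : Vec ℕ n} → y ≤ᵥ x → 1 ≤ changed x y → changed x y ≤ k →
           y ∈ moves k x
∈-moves⁺ k {x} y≤x one atMostK =
  ∈-filter⁺ (λ y → T? (isMove k x y)) (∈-below⁺ y≤x)
    (Equivalence.from T-∧ (≤⇒≤ᵇ one , ≤⇒≤ᵇ atMostK))

S-changed : ∀ {n} {x y : Vec ℕ n} → y ≤ᵥ x → S y + changed x y ≤ S x
S-changed [] = z≤n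
S-changed {x = a ∷ x} {b ∷ y} (b≤a ∷ y≤x) = begin
  b + S y + (changedAt a b + changed x y)   ≡⟨ interchange b (S y) (changedAt a b) (changed x y) ⟩
  (b + changedAt a b) + (S y + changed x y) ≤⟨ +-mono-≤ pile (S-changed y≤x) ⟩
  a + S x                                   ∎
  where
  open ≤-Reasoning
  pile : b + changedAt a b ≤ a
  pile with b <? a
  ... | yes b<a rewrite changedAt-< b<a | +-comm b 1 = b<a
  ... | no b≮a  rewrite changedAt-≥ (≮⇒≥ b≮a) | +-identityʳ b = b≤a

S-move : ∀ {n} k (x : Vec ℕ n) {y} → y ∈ moves k x → S y < S x
S-move k x {y} y∈ with y≤x , one , _ ← ∈-moves⁻ k x y∈ = begin-strict
  S y                ≡⟨ +-comm 0 (S y) ⟩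
  S y + 0            <⟨ +-monoʳ-< (S y) one ⟩
  S y + changed x y  ≤⟨ S-changed y≤x ⟩
  S x                ∎
  where open ≤-Reasoning

changed≡0⇒≡ : ∀ {n} {x y : Vec ℕ n} → y ≤ᵥ x → changed x y ≡ 0 → y ≡ x
changed≡0⇒≡ [] _ = refl
changed≡0⇒≡ {x = a ∷ x} {b ∷ y} (b≤a ∷ y≤x) none with b <? a
... | yes b<a rewrite changedAt-< b<a = contradiction none λ ()
... | no b≮a  rewrite changedAt-≥ (≮⇒≥ b≮a) =
  cong₂ _∷_ (≤-antisym b≤a (≮⇒≥ b≮a)) (changed≡0⇒≡ y≤x none)

changed-self : ∀ {n} (x : Vec ℕ n) → changed x x ≡ 0
changed-self []      = refl
changed-self (a ∷ x) = cong₂ _+_ (changedAt-≥ (≤-refl {a})) (changed-self x)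

<S⇒changed≥1 : ∀ {n} {x y : Vec ℕ n} → y ≤ᵥ x → S y < S x → 1 ≤ changed x y
<S⇒changed≥1 {x = x} {y} y≤x Sy<Sx with changed x y in none
... | suc _ = s≤s z≤n
... | zero  = contradiction (cong S (changed≡0⇒≡ y≤x none)) (<⇒≢ Sy<Sx)

one-stone⇒changed≡1 : ∀ {n} {x y : Vec ℕ n} → y ≤ᵥ x → S x ≡ suc (S y) → changed x y ≡ 1
one-stone⇒changed≡1 {x = x} {y} y≤x Sx≡1+Sy =
  ≤-antisym atMostOne (<S⇒changed≥1 y≤x (subst (S y <_) (sym Sx≡1+Sy) ≤-refl))
  where
  atMostOne : changed x y ≤ 1
  atMostOne = +-cancelˡ-≤ (S y) _ _
    (subst (S y + changed x y ≤_) (trans Sx≡1+Sy (+-comm 1 (S y))) (S-changed y≤x))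

changed-trans : ∀ {n} {x y z : Vec ℕ n} → z ≤ᵥ y → y ≤ᵥ x →
                changed x z ≤ changed x y + changed y z
changed-trans [] [] = z≤n
changed-trans {x = a ∷ x} {b ∷ y} {c ∷ z} (c≤b ∷ z≤y) (b≤a ∷ y≤x) = begin
  changedAt a c + changed x z
    ≤⟨ +-mono-≤ pile (changed-trans z≤y y≤x) ⟩
  changedAt a b + changedAt b c + (changed x y + changed y z)
    ≡⟨ interchange (changedAt a b) (changedAt b c) (changed x y) (changed y z) ⟩
  changedAt a b + changed x y + (changedAt b c + changed y z) ∎
  where
  open ≤-Reasoning
  pile : changedAt a c ≤ changedAt a b + changedAt b c
  pile with c <? a | b <? a
  ... | no c≮a | _ rewrite changedAt-≥ (≮⇒≥ c≮a) = z≤n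
  ... | yes _ | yes b<a rewrite changedAt-< b<a = ≤-trans (changedAt≤1 a c) (m≤m+n 1 _)
  ... | yes c<a | no b≮a rewrite ≤-antisym b≤a (≮⇒≥ b≮a) | changedAt-≥ (≤-refl {a}) = ≤-refl

remStep : List ℕ → ℕ
remStep [] = 0
remStep (r ∷ rs) with evensOf (r ∷ rs)
... | e ∷ es = suc (minList e es)
... | []     = suc (maxList (r ∷ rs))

remF-suc : ∀ {n} k f (x : Vec ℕ n) → remF k (suc f) x ≡ remStep (map (remF k f) (moves k x))
remF-suc k f x with map (remF k f) (moves k x)
... | [] = refl
... | r ∷ rs with evensOf (r ∷ rs)
...   | _ ∷ _ = refl
...   | []    = refl

moves-terminal : ∀ {n} k (x : Vec ℕ n) → S x ≡ 0 → moves k x ≡ []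
moves-terminal k x Sx≡0 with moves k x in eq
... | []    = refl
... | y ∷ _ = contradiction (subst (S y <_) Sx≡0 (S-move k x (subst (y ∈_) (sym eq) (here refl)))) n≮0

remF-terminal : ∀ {n} k f (x : Vec ℕ n) → S x ≡ 0 → remF k f x ≡ 0
remF-terminal k zero    x _    = refl
remF-terminal k (suc f) x Sx≡0 rewrite remF-suc k f x | moves-terminal k x Sx≡0 = refl

remF-fuel : ∀ {n} k f g (x : Vec ℕ n) → S x ≤ f → S x ≤ g → remF k f x ≡ remF k g x
remF-fuel k zero    g       x Sx≤0 _    = sym (remF-terminal k g x (n≤0⇒n≡0 Sx≤0))
remF-fuel k (suc f) zero    x _    Sx≤0 = remF-terminal k (suc f) x (n≤0⇒n≡0 Sx≤0)
remF-fuel k (suc f) (suc g) x Sx≤f Sx≤g = begin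
  remF k (suc f) x                          ≡⟨ remF-suc k f x ⟩
  remStep (map (remF k f) (moves k x))      ≡⟨ cong remStep (map-cong-local (All.tabulate successor)) ⟩
  remStep (map (remF k g) (moves k x))      ≡⟨ remF-suc k g x ⟨
  remF k (suc g) x                          ∎
  where
  open ≡-Reasoning
  successor : ∀ {y} → y ∈ moves k x → remF k f y ≡ remF k g y
  successor y∈ = remF-fuel k f g _ (≤-pred (≤-trans (S-move k x y∈) Sx≤f))
                                   (≤-pred (≤-trans (S-move k x y∈) Sx≤g))

remoteness-unfold : ∀ {n} k (x : Vec ℕ n) →
                    remoteness k x ≡ remStep (map (remoteness k) (moves k x))
remoteness-unfold k x with S x in eq
... | zero  rewrite moves-terminal k x eq = refl
... | suc f = trans (remF-suc k f x) (cong remStep (map-cong-local (All.tabulate successor)))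
  where
  successor : ∀ {y} → y ∈ moves k x → remF k f y ≡ remoteness k y
  successor y∈ = remF-fuel k f _ _ (≤-pred (subst (_ <_) eq (S-move k x y∈))) ≤-refl

even⇒¬even-suc : ∀ n → Even n → ¬ Even (suc n)
even⇒¬even-suc n ev with evenᵇ n
... | true  = λ ()
... | false = ⊥-elim ev

¬even⇒even-suc : ∀ n → ¬ Even n → Even (suc n)
¬even⇒even-suc n odd with evenᵇ n
... | true  = ⊥-elim (odd tt)
... | false = tt

minList-preserves : ∀ (P : ℕ → Set) {d} es → P d → All P es → P (minList d es)
minList-preserves P []       Pd []         = Pd
minList-preserves P {d} (r ∷ rs) Pd (Pr ∷ Prs) with ⊓-sel d r
... | inj₁ d⊓r≡d = minList-preserves P rs (subst P (sym d⊓r≡d) Pd) Prs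
... | inj₂ d⊓r≡r = minList-preserves P rs (subst P (sym d⊓r≡r) Pr) Prs

maxList-∈ : ∀ r rs → maxList (r ∷ rs) ∈ r ∷ rs
maxList-∈ r []       = here (⊔-identityʳ r)
maxList-∈ r (s ∷ rs) with ⊔-sel r (maxList (s ∷ rs))
... | inj₁ eq = here eq
... | inj₂ eq = there (subst (_∈ s ∷ rs) (sym eq) (maxList-∈ s rs))

maxList-≥ : ∀ {r} rs → r ∈ rs → r ≤ maxList rs
maxList-≥ (s ∷ rs) (here refl) = m≤m⊔n s (maxList rs)
maxList-≥ (s ∷ rs) (there r∈)  = ≤-trans (maxList-≥ rs r∈) (m≤n⊔m s (maxList rs))

∈-evensOf⁻ : ∀ {rs e} → e ∈ evensOf rs → e ∈ rs × Even e
∈-evensOf⁻ {rs} = ∈-filter⁻ (λ r → T? (evenᵇ r)) {xs = rs}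

∈-evensOf⁺ : ∀ {rs e} → e ∈ rs → Even e → e ∈ evensOf rs
∈-evensOf⁺ = ∈-filter⁺ (λ r → T? (evenᵇ r))

minList-evensOf : ∀ rs {e es} → evensOf rs ≡ e ∷ es →
                  minList e es ∈ rs × Even (minList e es)
minList-evensOf rs {e} {es} eq with e-ok ∷ es-ok ← subst (All _) eq (All.tabulate ∈-evensOf⁻)
  = minList-preserves (_∈ rs) es (proj₁ e-ok) (All.map proj₁ es-ok)
  , minList-preserves Even es (proj₂ e-ok) (All.map proj₂ es-ok)

remStep-odd : ∀ rs → ¬ Even (remStep rs) → ∃ λ e → e ∈ rs × Even e × remStep rs ≡ suc e
remStep-odd []       odd = contradiction tt odd
remStep-odd (r ∷ rs) odd with evensOf (r ∷ rs) in eq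
... | e ∷ es = minList e es , proj₁ (minList-evensOf (r ∷ rs) eq) , proj₂ (minList-evensOf (r ∷ rs) eq) , refl
... | []     = contradiction (¬even⇒even-suc (maxList (r ∷ rs)) maxOdd) odd
  where
  maxOdd : ¬ Even (maxList (r ∷ rs))
  maxOdd ev with () ← subst (maxList (r ∷ rs) ∈_) eq (∈-evensOf⁺ {r ∷ rs} (maxList-∈ r rs) ev)

remStep-even⇒no-evens : ∀ rs → Even (remStep rs) → evensOf rs ≡ []
remStep-even⇒no-evens []       _  = refl
remStep-even⇒no-evens (r ∷ rs) ev with evensOf (r ∷ rs) in eq
... | e ∷ es = contradiction ev (even⇒¬even-suc (minList e es) (proj₂ (minList-evensOf (r ∷ rs) eq)))
... | []     = refl

remStep-even⇒odd : ∀ {rs r} → Even (remStep rs) → r ∈ rs → ¬ Even r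
remStep-even⇒odd {rs} {r} ev r∈ er with () ← subst (r ∈_) (remStep-even⇒no-evens rs ev) (∈-evensOf⁺ {rs} r∈ er)

remStep-even⇒max : ∀ {rs r} → Even (remStep rs) → r ∈ rs →
                   ∃ λ m → m ∈ rs × remStep rs ≡ suc m × r ≤ m
remStep-even⇒max {r₀ ∷ rs} ev r∈ with evensOf (r₀ ∷ rs) in eq
... | e ∷ es = contradiction ev (even⇒¬even-suc (minList e es) (proj₂ (minList-evensOf (r₀ ∷ rs) eq)))
... | []     = maxList (r₀ ∷ rs) , maxList-∈ r₀ rs , refl , maxList-≥ (r₀ ∷ rs) r∈

module _ {n : ℕ} (k : ℕ) where

  N⇒P-move : ∀ (x : Vec ℕ n) → ¬ IsP k x →
             ∃ λ y → y ∈ moves k x × IsP k y × remoteness k x ≡ suc (remoteness k y)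
  N⇒P-move x notP with remStep-odd _ (notP ∘ subst Even (sym (remoteness-unfold k x)))
  ... | e , e∈ , ev , eq with ∈-map⁻ (remoteness k) e∈
  ...   | y , y∈ , e≡ = y , y∈ , subst Even e≡ ev , trans (remoteness-unfold k x) (trans eq (cong suc e≡))

  P⇒N-moves : ∀ (x : Vec ℕ n) {y} → IsP k x → y ∈ moves k x → ¬ IsP k y
  P⇒N-moves x {y} isP y∈ =
    remStep-even⇒odd (subst Even (remoteness-unfold k x) isP) (∈-map⁺ (remoteness k) y∈)

  P⇒max-move : ∀ (x : Vec ℕ n) {y} → IsP k x → y ∈ moves k x →
               ∃ λ y′ → y′ ∈ moves k x × remoteness k x ≡ suc (remoteness k y′) ×
                        remoteness k y ≤ remoteness k y′
  P⇒max-move x isP y∈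
    with remStep-even⇒max (subst Even (remoteness-unfold k x) isP) (∈-map⁺ (remoteness k) y∈)
  ... | m , m∈ , eq , y≤m with ∈-map⁻ (remoteness k) m∈
  ...   | y′ , y′∈ , m≡ = y′ , y′∈ , trans (remoteness-unfold k x) (trans eq (cong suc m≡)) , subst (_ ≤_) m≡ y≤m

bit : ℕ → ℕ
bit 0             = 0
bit 1             = 1
bit (suc (suc n)) = bit n

bit≤1 : ∀ n → bit n ≤ 1
bit≤1 0             = z≤n
bit≤1 1             = ≤-refl
bit≤1 (suc (suc n)) = bit≤1 n

bit+⌊n/2⌋+⌊n/2⌋≡n : ∀ n → bit n + (⌊ n /2⌋ + ⌊ n /2⌋) ≡ n
bit+⌊n/2⌋+⌊n/2⌋≡n 0             = refl
bit+⌊n/2⌋+⌊n/2⌋≡n 1             = refl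
bit+⌊n/2⌋+⌊n/2⌋≡n (suc (suc n)) =
  trans (shift (bit n) ⌊ n /2⌋) (cong (suc ∘ suc) (bit+⌊n/2⌋+⌊n/2⌋≡n n))
  where
  shift : ∀ b h → b + (suc h + suc h) ≡ suc (suc (b + (h + h)))
  shift = solve-∀

⌊n+n/2⌋≡n : ∀ n → ⌊ n + n /2⌋ ≡ n
⌊n+n/2⌋≡n n = sym (n≡⌊n+n/2⌋ n)

⌊1+n+n/2⌋≡n : ∀ n → ⌊ suc (n + n) /2⌋ ≡ n
⌊1+n+n/2⌋≡n zero    = refl
⌊1+n+n/2⌋≡n (suc n) = cong suc (trans (cong ⌊_/2⌋ (+-suc n n)) (⌊1+n+n/2⌋≡n n))

bit[n+n]≡0 : ∀ n → bit (n + n) ≡ 0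
bit[n+n]≡0 zero    = refl
bit[n+n]≡0 (suc n) = trans (cong (bit ∘ suc) (+-suc n n)) (bit[n+n]≡0 n)

bit[1+n+n]≡1 : ∀ n → bit (suc (n + n)) ≡ 1
bit[1+n+n]≡1 zero    = refl
bit[1+n+n]≡1 (suc n) = trans (cong (bit ∘ suc ∘ suc) (+-suc n n)) (bit[1+n+n]≡1 n)

bit-step : ∀ {a b} → b < a → ⌊ b /2⌋ ≡ ⌊ a /2⌋ → bit a ≡ suc (bit b)
bit-step {1}             {0}             _                _  = refl
bit-step {1}             {suc _}         (s≤s ())         _
bit-step {suc (suc a)}   {0}             _                ()
bit-step {suc (suc a)}   {1}             _                ()
bit-step {suc (suc a)}   {suc (suc b)}   (s≤s (s≤s b<a))  eq = bit-step b<a (suc-injective eq)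

halve : ∀ {n} → Vec ℕ n → Vec ℕ n
halve = Vec.map ⌊_/2⌋

oddCount : ∀ {n} → Vec ℕ n → ℕ
oddCount x = S (Vec.map bit x)

-- digitSum b x counts the piles whose binary digit of weight 2^b is 1.
digitSum : ∀ {n} → ℕ → Vec ℕ n → ℕ
digitSum zero    x = oddCount x
digitSum (suc b) x = digitSum b (halve x)

Balanced : ∀ {n} → ℕ → Vec ℕ n → Set
Balanced k x = ∀ b → suc k ∣ digitSum b x

S-halve : ∀ {n} (x : Vec ℕ n) → oddCount x + (S (halve x) + S (halve x)) ≡ S x
S-halve []      = refl
S-halve (a ∷ x) =
  trans (rearrange (bit a) (oddCount x) ⌊ a /2⌋ (S (halve x)))
        (cong₂ _+_ (bit+⌊n/2⌋+⌊n/2⌋≡n a) (S-halve x))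
  where
  rearrange : ∀ p q r s → p + q + (r + s + (r + s)) ≡ p + (r + r) + (q + (s + s))
  rearrange = solve-∀

digitSum≤S : ∀ {n} b (x : Vec ℕ n) → digitSum b x ≤ S x
digitSum≤S zero    x = ≤-trans (m≤m+n (oddCount x) _) (≤-reflexive (S-halve x))
digitSum≤S (suc b) x = ≤-trans (digitSum≤S b (halve x))
                         (≤-trans (m≤m+n _ _) (≤-trans (m≤n+m _ (oddCount x)) (≤-reflexive (S-halve x))))

Balanced-S≡0 : ∀ {n} k {x : Vec ℕ n} → S x ≡ 0 → Balanced k x
Balanced-S≡0 k {x} Sx≡0 b = divides 0 (n≤0⇒n≡0 (subst (digitSum b x ≤_) Sx≡0 (digitSum≤S b x)))

S-halve< : ∀ {n} (x : Vec ℕ n) → 0 < S x → S (halve x) < S x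
S-halve< x = half< (≤-trans (m≤n+m _ (oddCount x)) (≤-reflexive (S-halve x)))
  where
  half< : ∀ {h s} → h + h ≤ s → 0 < s → h < s
  half< {zero}  _    pos = pos
  half< {suc h} 2h≤s _   = <-≤-trans (m<m+n (suc h) z<s) 2h≤s

S-halve>0 : ∀ {n} (x : Vec ℕ n) → oddCount x ≡ 0 → 0 < S x → 0 < S (halve x)
S-halve>0 x even pos = n≢0⇒n>0 λ Shx≡0 →
  n>0⇒n≢0 pos (trans (sym (S-halve x)) (cong₂ (λ o h → o + (h + h)) even Shx≡0))

halve-mono : ∀ {n} {x y : Vec ℕ n} → y ≤ᵥ x → halve y ≤ᵥ halve x
halve-mono = Pointwise.map⁺ ⌊n/2⌋-mono

changed-halve : ∀ {n} {x y : Vec ℕ n} → y ≤ᵥ x → changed (halve x) (halve y) ≤ changed x y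
changed-halve [] = z≤n
changed-halve {x = a ∷ _} {b ∷ _} (b≤a ∷ y≤x) = +-mono-≤ pile (changed-halve y≤x)
  where
  pile : changedAt ⌊ a /2⌋ ⌊ b /2⌋ ≤ changedAt a b
  pile with b <? a
  ... | yes b<a rewrite changedAt-< b<a = changedAt≤1 ⌊ a /2⌋ ⌊ b /2⌋
  ... | no b≮a rewrite ≤-antisym b≤a (≮⇒≥ b≮a) | changedAt-≥ (≤-refl {⌊ a /2⌋}) = z≤n

same-halve⇒oddCount : ∀ {n} {x y : Vec ℕ n} → y ≤ᵥ x → halve y ≡ halve x →
                      oddCount x ≡ oddCount y + changed x y
same-halve⇒oddCount [] _ = refl
same-halve⇒oddCount {x = a ∷ x} {b ∷ y} (b≤a ∷ y≤x) eq with halves , rest ← ∷-injective eq =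
  trans (cong₂ _+_ pile (same-halve⇒oddCount y≤x rest))
        (interchange (bit b) (changedAt a b) (oddCount y) (changed x y))
  where
  pile : bit a ≡ bit b + changedAt a b
  pile with b <? a
  ... | yes b<a rewrite changedAt-< b<a = trans (bit-step b<a halves) (+-comm 1 (bit b))
  ... | no b≮a rewrite ≤-antisym b≤a (≮⇒≥ b≮a) | changedAt-≥ (≤-refl {a}) = sym (+-identityʳ (bit a))

same-halve⇒S : ∀ {n} {x y : Vec ℕ n} → y ≤ᵥ x → halve y ≡ halve x → S x ≡ S y + changed x y
same-halve⇒S {x = x} {y} y≤x eq = begin
  S x                                                 ≡⟨ S-halve x ⟨
  oddCount x + (S (halve x) + S (halve x))            ≡⟨ cong₂ (λ o h → o + (h + h)) (same-halve⇒oddCount y≤x eq) (cong S (sym eq)) ⟩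
  oddCount y + changed x y + (S (halve y) + S (halve y)) ≡⟨ swap (oddCount y) (changed x y) (S (halve y)) ⟩
  oddCount y + (S (halve y) + S (halve y)) + changed x y ≡⟨ cong (_+ changed x y) (S-halve y) ⟩
  S y + changed x y                                   ∎
  where
  open ≡-Reasoning
  swap : ∀ p q r → p + q + (r + r) ≡ p + (r + r) + q
  swap = solve-∀

∣∧<⇒≡0 : ∀ {d m} → d ∣ m → m < d → m ≡ 0
∣∧<⇒≡0 {m = zero}  _   _   = refl
∣∧<⇒≡0 {m = suc m} d∣m m<d = contradiction (∣⇒≤ d∣m) (<⇒≱ m<d)

balanced-separated : ∀ {n} k {x y : Vec ℕ n} → y ≤ᵥ x → Balanced k x → Balanced k y →
                     changed x y ≤ k → y ≡ x
balanced-separated k {x} = S-induction _ step x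
  where
  step : ∀ x → (∀ x′ → S x′ < S x → ∀ {y} → y ≤ᵥ x′ → Balanced k x′ → Balanced k y →
                                       changed x′ y ≤ k → y ≡ x′) →
         ∀ {y} → y ≤ᵥ x → Balanced k x → Balanced k y → changed x y ≤ k → y ≡ x
  step x IH {y} y≤x balx baly few with S x ≟ 0
  ... | yes Sx≡0 = changed≡0⇒≡ y≤x
    (n≤0⇒n≡0 (≤-trans (m≤n+m _ (S y)) (subst (S y + changed x y ≤_) Sx≡0 (S-changed y≤x))))
  ... | no Sx≢0  = changed≡0⇒≡ y≤x (∣∧<⇒≡0 k+1∣changed (s≤s few))
    where
    halves : halve y ≡ halve x
    halves = IH (halve x) (S-halve< x (n≢0⇒n>0 Sx≢0)) (halve-mono y≤x) (balx ∘ suc) (baly ∘ suc)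
                (≤-trans (changed-halve y≤x) few)
    k+1∣changed : suc k ∣ changed x y
    k+1∣changed = ∣m+n∣m⇒∣n (subst (suc k ∣_) (same-halve⇒oddCount y≤x halves) (balx 0)) (baly 0)

balanced-far : ∀ {n} k {x y : Vec ℕ n} → y ≤ᵥ x → Balanced k x → Balanced k y → S y < S x →
               suc k ≤ changed x y
balanced-far k {x} {y} y≤x balx baly Sy<Sx with suc k ≤? changed x y
... | yes far  = far
... | no ¬far = contradiction (balanced-separated k y≤x balx baly (≤-pred (≰⇒> ¬far))) (<⇒≢ Sy<Sx ∘ cong S)

lift : ∀ {n} → ℕ → Vec ℕ n → Vec ℕ n → Vec ℕ n
lift j [] [] = []
lift zero (a ∷ x) (a′ ∷ y′) with a′ <ᵇ ⌊ a /2⌋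
... | true  = a′ + a′ ∷ lift zero x y′
... | false = a ∷ lift zero x y′
lift (suc j) (a ∷ x) (a′ ∷ y′) with a′ <ᵇ ⌊ a /2⌋
... | true  = suc (a′ + a′) ∷ lift j x y′
... | false = a ∷ lift (suc j) x y′

1+n+n<a : ∀ {n} a → n < ⌊ a /2⌋ → suc (n + n) < a
1+n+n<a {n} a n<h = begin-strict
  suc (n + n)               <⟨ s≤s (+-monoʳ-< n (n<1+n n)) ⟩
  suc (n + suc n)           ≡⟨⟩
  suc n + suc n             ≤⟨ +-mono-≤ n<h n<h ⟩
  ⌊ a /2⌋ + ⌊ a /2⌋          ≤⟨ m≤n+m _ (bit a) ⟩
  bit a + (⌊ a /2⌋ + ⌊ a /2⌋) ≡⟨ bit+⌊n/2⌋+⌊n/2⌋≡n a ⟩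
  a                         ∎
  where open ≤-Reasoning

halve-lift : ∀ {n} j {x y′ : Vec ℕ n} → y′ ≤ᵥ halve x → halve (lift j x y′) ≡ y′
halve-lift j {[]} {[]} [] = refl
halve-lift zero {a ∷ x} {a′ ∷ y′} (a′≤ ∷ y′≤) with a′ <ᵇ ⌊ a /2⌋ in lowered
... | true  = cong₂ _∷_ (⌊n+n/2⌋≡n a′) (halve-lift 0 y′≤)
... | false = cong₂ _∷_ (≤-antisym (<ᵇ≡false⇒≥ a′ ⌊ a /2⌋ lowered) a′≤) (halve-lift 0 y′≤)
halve-lift (suc j) {a ∷ x} {a′ ∷ y′} (a′≤ ∷ y′≤) with a′ <ᵇ ⌊ a /2⌋ in lowered
... | true  = cong₂ _∷_ (⌊1+n+n/2⌋≡n a′) (halve-lift j y′≤)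
... | false = cong₂ _∷_ (≤-antisym (<ᵇ≡false⇒≥ a′ ⌊ a /2⌋ lowered) a′≤) (halve-lift (suc j) y′≤)

lift≤ : ∀ {n} j (x y′ : Vec ℕ n) → lift j x y′ ≤ᵥ x
lift≤ j [] [] = []
lift≤ zero (a ∷ x) (a′ ∷ y′) with a′ <ᵇ ⌊ a /2⌋ in lowered
... | true  = <⇒≤ (<-trans (n<1+n _) (1+n+n<a a (<ᵇ≡true⇒< a′ ⌊ a /2⌋ lowered))) ∷ lift≤ 0 x y′
... | false = ≤-refl ∷ lift≤ 0 x y′
lift≤ (suc j) (a ∷ x) (a′ ∷ y′) with a′ <ᵇ ⌊ a /2⌋ in lowered
... | true  = <⇒≤ (1+n+n<a a (<ᵇ≡true⇒< a′ ⌊ a /2⌋ lowered)) ∷ lift≤ j x y′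
... | false = ≤-refl ∷ lift≤ (suc j) x y′

changed-lift : ∀ {n} j (x y′ : Vec ℕ n) → changed x (lift j x y′) ≡ changed (halve x) y′
changed-lift j [] [] = refl
changed-lift zero (a ∷ x) (a′ ∷ y′) with a′ <ᵇ ⌊ a /2⌋ in lowered
... | true  =
  cong₂ _+_ (changedAt-< (<-trans (n<1+n _) (1+n+n<a a (<ᵇ≡true⇒< a′ ⌊ a /2⌋ lowered)))) (changed-lift 0 x y′)
... | false = cong₂ _+_ (changedAt-≥ (≤-refl {a})) (changed-lift 0 x y′)
changed-lift (suc j) (a ∷ x) (a′ ∷ y′) with a′ <ᵇ ⌊ a /2⌋ in lowered
... | true  = cong₂ _+_ (changedAt-< (1+n+n<a a (<ᵇ≡true⇒< a′ ⌊ a /2⌋ lowered))) (changed-lift j x y′)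
... | false = cong₂ _+_ (changedAt-≥ (≤-refl {a})) (changed-lift (suc j) x y′)

oddCount-lift : ∀ {n} j (x y′ : Vec ℕ n) → j ≤ changed (halve x) y′ →
                oddCount (lift j x y′) ≡ oddCount (lift 0 x y′) + j
oddCount-lift zero x y′ _ = sym (+-identityʳ _)
oddCount-lift (suc j) [] [] ()
oddCount-lift (suc j) (a ∷ x) (a′ ∷ y′) j<t with a′ <ᵇ ⌊ a /2⌋
... | true  = begin
  bit (suc (a′ + a′)) + oddCount (lift j x y′)      ≡⟨ cong₂ _+_ (bit[1+n+n]≡1 a′) (oddCount-lift j x y′ (≤-pred j<t)) ⟩
  1 + (oddCount (lift 0 x y′) + j)                 ≡⟨ cong suc (+-comm (oddCount (lift 0 x y′)) j) ⟩
  suc j + oddCount (lift 0 x y′)                   ≡⟨ +-comm (suc j) _ ⟩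
  oddCount (lift 0 x y′) + suc j                   ≡⟨ cong (λ b → b + oddCount (lift 0 x y′) + suc j) (bit[n+n]≡0 a′) ⟨
  bit (a′ + a′) + oddCount (lift 0 x y′) + suc j   ∎
  where open ≡-Reasoning
... | false = trans (cong (bit a +_) (oddCount-lift (suc j) x y′ j<t)) (sym (+-assoc (bit a) _ (suc j)))

clearOdd : ∀ {n} → ℕ → Vec ℕ n → Vec ℕ n
clearOdd zero    z       = z
clearOdd (suc m) []      = []
clearOdd (suc m) (c ∷ z) with bit c
... | zero  = c ∷ clearOdd (suc m) z
... | suc _ = ⌊ c /2⌋ + ⌊ c /2⌋ ∷ clearOdd m z

clearOdd≤ : ∀ {n} m (z : Vec ℕ n) → clearOdd m z ≤ᵥ z
clearOdd≤ zero    z       = ≤ᵥ-refl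
clearOdd≤ (suc m) []      = []
clearOdd≤ (suc m) (c ∷ z) with bit c
... | zero  = ≤-refl ∷ clearOdd≤ (suc m) z
... | suc _ = ≤-trans (m≤n+m _ (bit c)) (≤-reflexive (bit+⌊n/2⌋+⌊n/2⌋≡n c)) ∷ clearOdd≤ m z

halve-clearOdd : ∀ {n} m (z : Vec ℕ n) → halve (clearOdd m z) ≡ halve z
halve-clearOdd zero    z       = refl
halve-clearOdd (suc m) []      = refl
halve-clearOdd (suc m) (c ∷ z) with bit c
... | zero  = cong (⌊ c /2⌋ ∷_) (halve-clearOdd (suc m) z)
... | suc _ = cong₂ _∷_ (⌊n+n/2⌋≡n ⌊ c /2⌋) (halve-clearOdd m z)

changed-clearOdd : ∀ {n} m (z : Vec ℕ n) → changed z (clearOdd m z) ≤ m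
changed-clearOdd zero    z       = ≤-reflexive (changed-self z)
changed-clearOdd (suc m) []      = z≤n
changed-clearOdd (suc m) (c ∷ z) with bit c
... | zero  = ≤-trans (≤-reflexive (cong (_+ _) (changedAt-≥ (≤-refl {c})))) (changed-clearOdd (suc m) z)
... | suc _ = +-mono-≤ (changedAt≤1 c _) (changed-clearOdd m z)

oddCount-clearOdd : ∀ {n} m (z : Vec ℕ n) → m ≤ oddCount z → oddCount (clearOdd m z) + m ≡ oddCount z
oddCount-clearOdd zero    z       _ = +-identityʳ _
oddCount-clearOdd (suc m) []      ()
oddCount-clearOdd (suc m) (c ∷ z) m<o with bit c in even | bit≤1 c
... | zero  | _ = trans (cong (λ b → b + _ + suc m) even) (oddCount-clearOdd (suc m) z m<o)
... | suc zero | _ = begin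
  bit (⌊ c /2⌋ + ⌊ c /2⌋) + oddCount (clearOdd m z) + suc m ≡⟨ cong (λ b → b + _ + suc m) (bit[n+n]≡0 ⌊ c /2⌋) ⟩
  oddCount (clearOdd m z) + suc m                          ≡⟨ +-suc _ m ⟩
  suc (oddCount (clearOdd m z) + m)                        ≡⟨ cong suc (oddCount-clearOdd m z (≤-pred m<o)) ⟩
  suc (oddCount z)                                         ∎
  where open ≡-Reasoning
... | suc (suc _) | s≤s ()

Balanced-intro : ∀ {n} k {y : Vec ℕ n} → suc k ∣ oddCount y → Balanced k (halve y) → Balanced k y
Balanced-intro k k+1∣odd bal zero    = k+1∣odd
Balanced-intro k k+1∣odd bal (suc b) = bal b

-- In balancing-move, t piles have a lowered half and u of the others are odd; giving j of the
-- former an odd value and making m of the latter even leaves u + j − m odd piles, a multiple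
-- of k + 1, with at most t + m ≤ k piles changed.
balancing-counts : ∀ k t u → t ≤ k →
  ∃ λ j → ∃ λ m → j ≤ t × m ≤ u × t + m ≤ k × (∀ L → L + m ≡ u + j → suc k ∣ L)
balancing-counts k t u t≤k with t + u % suc k ≤? k
... | yes fits = 0 , r , z≤n , m%n≤m u (suc k) , fits , λ L eq →
  divides q (+-cancelˡ-≡ r _ _ (begin
    r + L      ≡⟨ +-comm r L ⟩
    L + r      ≡⟨ eq ⟩
    u + 0      ≡⟨ +-identityʳ u ⟩
    u          ≡⟨ m≡m%n+[m/n]*n u (suc k) ⟩
    r + q * suc k ∎))
  where
  open ≡-Reasoning
  r = u % suc k
  q = u / suc k
... | no overflow = suc k ∸ r , 0 , j≤t , z≤n , subst (_≤ k) (sym (+-identityʳ t)) t≤k , λ L eq →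
  divides (suc q) (begin
    L                                 ≡⟨ +-identityʳ L ⟨
    L + 0                             ≡⟨ eq ⟩
    u + (suc k ∸ r)                   ≡⟨ cong (_+ (suc k ∸ r)) (m≡m%n+[m/n]*n u (suc k)) ⟩
    r + q * suc k + (suc k ∸ r)       ≡⟨ swap r (q * suc k) (suc k ∸ r) ⟩
    r + (suc k ∸ r) + q * suc k       ≡⟨ cong (_+ q * suc k) (m+[n∸m]≡n (<⇒≤ (m%n<n u (suc k)))) ⟩
    suc k + q * suc k                 ∎)
  where
  open ≡-Reasoning
  r = u % suc k
  q = u / suc k
  j≤t : suc k ∸ r ≤ t
  j≤t = m≤n+o⇒m∸n≤o (suc k) r (subst (suc k ≤_) (+-comm t r) (≰⇒> overflow))
  swap : ∀ a b c → a + b + c ≡ a + c + b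
  swap = solve-∀

balancing-move : ∀ {n} k (x : Vec ℕ n) → ∃ λ y → y ≤ᵥ x × Balanced k y × changed x y ≤ k
balancing-move k = S-induction _ step
  where
  step : ∀ x → (∀ x′ → S x′ < S x → ∃ λ y → y ≤ᵥ x′ × Balanced k y × changed x′ y ≤ k) →
         ∃ λ y → y ≤ᵥ x × Balanced k y × changed x y ≤ k
  step x IH with S x ≟ 0
  ... | yes Sx≡0 = x , ≤ᵥ-refl , Balanced-S≡0 k Sx≡0 , subst (_≤ k) (sym (changed-self x)) z≤n
  ... | no Sx≢0 with IH (halve x) (S-halve< x (n≢0⇒n>0 Sx≢0))
  ... | y′ , y′≤ , baly′ , few
    with balancing-counts k (changed (halve x) y′) (oddCount (lift 0 x y′)) few
  ...   | j , m , j≤t , m≤u , t+m≤k , divisible =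
    clearOdd m z , ≤ᵥ-trans (clearOdd≤ m z) (lift≤ j x y′) ,
    Balanced-intro k (divisible _ oddCounts) balHalves , fewChanges
    where
    z = lift j x y′
    oddCounts : oddCount (clearOdd m z) + m ≡ oddCount (lift 0 x y′) + j
    oddCounts = trans (oddCount-clearOdd m z m≤oddz) (oddCount-lift j x y′ j≤t)
      where
      m≤oddz = ≤-trans m≤u (≤-trans (m≤m+n _ j) (≤-reflexive (sym (oddCount-lift j x y′ j≤t))))
    balHalves : Balanced k (halve (clearOdd m z))
    balHalves b = subst (λ v → suc k ∣ digitSum b v)
                        (sym (trans (halve-clearOdd m z) (halve-lift j y′≤))) (baly′ b)
    fewChanges : changed x (clearOdd m z) ≤ k
    fewChanges = begin
      changed x (clearOdd m z)              ≤⟨ changed-trans (clearOdd≤ m z) (lift≤ j x y′) ⟩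
      changed x z + changed z (clearOdd m z) ≤⟨ +-mono-≤ (≤-reflexive (changed-lift j x y′)) (changed-clearOdd m z) ⟩
      changed (halve x) y′ + m              ≤⟨ t+m≤k ⟩
      k                                     ∎
      where open ≤-Reasoning

oddCount-lift0≤ : ∀ {n} (x y′ : Vec ℕ n) → oddCount (lift 0 x y′) ≤ oddCount x
oddCount-lift0≤ [] [] = z≤n
oddCount-lift0≤ (a ∷ x) (a′ ∷ y′) with a′ <ᵇ ⌊ a /2⌋
... | true  = +-mono-≤ (≤-trans (≤-reflexive (bit[n+n]≡0 a′)) z≤n) (oddCount-lift0≤ x y′)
... | false = +-monoʳ-≤ (bit a) (oddCount-lift0≤ x y′)

-- If every pile with a lowered half was made odd, an all-even z below lift j x y′ changes each
-- such pile, so counting its changes from x instead costs nothing.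
changed-lift≤ : ∀ {n} j (x y′ z : Vec ℕ n) → changed (halve x) y′ ≤ j → z ≤ᵥ lift j x y′ →
                oddCount z ≡ 0 → changed x z ≤ changed (lift j x y′) z
changed-lift≤ j [] [] [] _ [] _ = z≤n
changed-lift≤ zero (a ∷ x) (a′ ∷ y′) (c ∷ z) t≤0 z≤y even with a′ <ᵇ ⌊ a /2⌋ | t≤0
... | true  | ()
... | false | t′≤0 =
  +-monoʳ-≤ (changedAt a c) (changed-lift≤ 0 x y′ z t′≤0 (Pointwise.tail z≤y) (m+n≡0⇒n≡0 (bit c) even))
changed-lift≤ (suc j) (a ∷ x) (a′ ∷ y′) (c ∷ z) t≤1+j z≤y even with a′ <ᵇ ⌊ a /2⌋
... | true  =
  +-mono-≤ pile (changed-lift≤ j x y′ z (≤-pred t≤1+j) (Pointwise.tail z≤y) (m+n≡0⇒n≡0 (bit c) even))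
  where
  c<odd : c < suc (a′ + a′)
  c<odd = ≤∧≢⇒< (Pointwise.head z≤y) λ { refl →
    contradiction (trans (sym (bit[1+n+n]≡1 a′)) (m+n≡0⇒m≡0 (bit c) even)) λ () }
  pile : changedAt a c ≤ changedAt (suc (a′ + a′)) c
  pile = subst (changedAt a c ≤_) (sym (changedAt-< c<odd)) (changedAt≤1 a c)
... | false =
  +-monoʳ-≤ (changedAt a c) (changed-lift≤ (suc j) x y′ z t≤1+j (Pointwise.tail z≤y) (m+n≡0⇒n≡0 (bit c) even))

Delays : ∀ {n} → ℕ → Vec ℕ n → Vec ℕ n → Set
Delays k x y = y ≤ᵥ x × S x ≡ suc (S y) ×
               (∀ {z} → z ≤ᵥ y → changed y z ≤ k → Balanced k z → S x ≤ S z + suc k)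

delays-clearOdd : ∀ {n} k {x : Vec ℕ n} → Balanced k x → 0 < oddCount x → Delays k x (clearOdd 1 x)
delays-clearOdd k {x} balx odd = y≤x , Sx≡1+Sy , far
  where
  y = clearOdd 1 x
  y≤x = clearOdd≤ 1 x
  halves : halve y ≡ halve x
  halves = halve-clearOdd 1 x
  one-change : changed x y ≡ 1
  one-change = +-cancelˡ-≡ (oddCount y) _ _
                 (trans (sym (same-halve⇒oddCount y≤x halves)) (sym (oddCount-clearOdd 1 x odd)))
  Sx≡1+Sy : S x ≡ suc (S y)
  Sx≡1+Sy = trans (same-halve⇒S y≤x halves) (trans (cong (S y +_) one-change) (+-comm (S y) 1))
  far : ∀ {z} → z ≤ᵥ y → changed y z ≤ k → Balanced k z → S x ≤ S z + suc k
  far {z} z≤y few balz = begin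
    S x                            ≡⟨ same-halve⇒S z≤x halvesz ⟩
    S z + changed x z              ≤⟨ +-monoʳ-≤ (S z) (changed-trans z≤y y≤x) ⟩
    S z + (changed x y + changed y z) ≡⟨ cong (λ c → S z + (c + changed y z)) one-change ⟩
    S z + suc (changed y z)        ≤⟨ +-monoʳ-≤ (S z) (s≤s few) ⟩
    S z + suc k                    ∎
    where
    open ≤-Reasoning
    z≤x = ≤ᵥ-trans z≤y y≤x
    halvesz : halve z ≡ halve x
    halvesz = balanced-separated k (halve-mono z≤x) (balx ∘ suc) (balz ∘ suc)
                (≤-trans (subst (λ h → changed h (halve z) ≤ changed y z) halves (changed-halve z≤y)) few)

S-lift1 : ∀ {n} {x y′ : Vec ℕ n} → y′ ≤ᵥ halve x → oddCount x ≡ 0 → S (halve x) ≡ suc (S y′) →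
          S x ≡ suc (S (lift 1 x y′))
S-lift1 {x = x} {y′} y′≤ even Shx≡1+Sy′ = begin
  S x                                            ≡⟨ S-halve x ⟨
  oddCount x + (S hx + S hx)                     ≡⟨ cong₂ (λ o s → o + (s + s)) even Shx≡1+Sy′ ⟩
  suc (S y′) + suc (S y′)                        ≡⟨ cong suc (+-suc (S y′) (S y′)) ⟩
  suc (1 + (S y′ + S y′))                        ≡⟨ cong (λ o → suc (o + (S y′ + S y′))) oddy ⟨
  suc (oddCount y + (S y′ + S y′))               ≡⟨ cong (λ h → suc (oddCount y + (S h + S h))) (halve-lift 1 y′≤) ⟨
  suc (oddCount y + (S (halve y) + S (halve y))) ≡⟨ cong suc (S-halve y) ⟩
  suc (S y)                                      ∎
  where
  open ≡-Reasoning
  y = lift 1 x y′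
  hx = halve x
  oddy : oddCount y ≡ 1
  oddy = trans (oddCount-lift 1 x y′ (≤-reflexive (sym (one-stone⇒changed≡1 y′≤ Shx≡1+Sy′))))
               (cong (_+ 1) (n≤0⇒n≡0 (subst (oddCount (lift 0 x y′) ≤_) even (oddCount-lift0≤ x y′))))

delays-lift : ∀ {n} k {x y′ : Vec ℕ n} → Balanced k x → oddCount x ≡ 0 → Delays k (halve x) y′ →
              Delays k x (lift 1 x y′)
delays-lift k {x} {y′} balx even (y′≤ , Shx≡1+Sy′ , far′) = lift≤ 1 x y′ , Sx≡1+Sy , far
  where
  y = lift 1 x y′
  hx = halve x
  halves : halve y ≡ y′
  halves = halve-lift 1 y′≤
  Sx≡1+Sy : S x ≡ suc (S y)
  Sx≡1+Sy = S-lift1 y′≤ even Shx≡1+Sy′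
  Sx≡2Shx : S x ≡ S hx + S hx
  Sx≡2Shx = trans (sym (S-halve x)) (cong (_+ (S hx + S hx)) even)
  far : ∀ {z} → z ≤ᵥ y → changed y z ≤ k → Balanced k z → S x ≤ S z + suc k
  far {z} z≤y few balz = begin
    S x                                          ≡⟨ Sx≡2Shx ⟩
    S hx + S hx                                  ≤⟨ +-mono-≤ Shx≤ Shx≤ ⟩
    (S hz + suc k) + (S hz + suc k)              ≡⟨ rearrange (S hz) (suc k) ⟩
    suc k + (S hz + S hz) + suc k                ≤⟨ +-monoˡ-≤ (suc k) (+-monoˡ-≤ (S hz + S hz) k<oddz) ⟩
    oddCount z + (S hz + S hz) + suc k           ≡⟨ cong (_+ suc k) (S-halve z) ⟩
    S z + suc k                                  ∎
    where
    open ≤-Reasoning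
    hz = halve z
    rearrange : ∀ a b → (a + b) + (a + b) ≡ b + (a + a) + b
    rearrange = solve-∀
    Shx≤ : S hx ≤ S hz + suc k
    Shx≤ = far′ (subst (hz ≤ᵥ_) halves (halve-mono z≤y))
           (≤-trans (subst (λ h → changed h hz ≤ changed y z) halves (changed-halve z≤y)) few) (balz ∘ suc)
    z≢x : z ≢ x
    z≢x refl = <⇒≱ (subst (S y <_) (sym Sx≡1+Sy) ≤-refl) (≤-trans (m≤m+n _ _) (S-changed z≤y))
    oneLowered : changed hx y′ ≤ 1
    oneLowered = ≤-reflexive (one-stone⇒changed≡1 y′≤ Shx≡1+Sy′)
    k<oddz : suc k ≤ oddCount z
    k<oddz with oddCount z in oddz
    ... | suc _ = ∣⇒≤ (subst (suc k ∣_) oddz (balz 0))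
    ... | zero  = contradiction (balanced-separated k (≤ᵥ-trans z≤y (lift≤ 1 x y′)) balx balz
                    (≤-trans (changed-lift≤ 1 x y′ z oneLowered z≤y oddz) few)) z≢x

delays⇒move : ∀ {n} k {x y : Vec ℕ n} → 0 < k → Delays k x y → y ∈ moves k x
delays⇒move k 0<k (y≤x , Sx≡1+Sy , _) =
  ∈-moves⁺ k y≤x (≤-reflexive (sym oneChange)) (subst (_≤ k) (sym oneChange) 0<k)
  where oneChange = one-stone⇒changed≡1 y≤x Sx≡1+Sy

delaying-move : ∀ {n} k (x : Vec ℕ n) → Balanced k x → 0 < S x → ∃ (Delays k x)
delaying-move k = S-induction _ step
  where
  step : ∀ x → (∀ x′ → S x′ < S x → Balanced k x′ → 0 < S x′ → ∃ (Delays k x′)) →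
         Balanced k x → 0 < S x → ∃ (Delays k x)
  step x IH balx pos with oddCount x in oddx
  ... | suc _ = clearOdd 1 x , delays-clearOdd k balx (subst (0 <_) (sym oddx) z<s)
  ... | zero with IH (halve x) (S-halve< x pos) (balx ∘ suc) (S-halve>0 x oddx pos)
  ...   | y′ , delays = lift 1 x y′ , delays-lift k balx oddx delays

two-more : ∀ K r s → r * K ≡ 2 * s → suc (suc r) * K ≡ 2 * (s + K)
two-more K r s eq = trans (cong (λ u → K + (K + u)) eq) (rearrange K s)
  where
  rearrange : ∀ K s → K + (K + 2 * s) ≡ 2 * (s + K)
  rearrange = solve-∀

module _ {n : ℕ} (k : ℕ) where

  IsP⇔Balanced : ∀ (x : Vec ℕ n) → IsP k x ⇔ Balanced k x
  IsP⇔Balanced = S-induction _ λ x IH → mk⇔ (P⇒balanced x IH) (balanced⇒P x IH)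
    where
    balanced⇒P : ∀ x → (∀ y → S y < S x → IsP k y ⇔ Balanced k y) → Balanced k x → IsP k x
    balanced⇒P x IH balx with T? (evenᵇ (remoteness k x))
    ... | yes isP = isP
    ... | no notP with y , y∈ , isPy , _ ← N⇒P-move k x notP with y≤x , _ , few ← ∈-moves⁻ k x y∈ =
      contradiction (balanced-far k y≤x balx (Equivalence.to (IH y (S-move k x y∈)) isPy) (S-move k x y∈))
                    (<⇒≱ (s≤s few))

    P⇒balanced : ∀ x → (∀ y → S y < S x → IsP k y ⇔ Balanced k y) → IsP k x → Balanced k x
    P⇒balanced x IH isP with y , y≤x , baly , few ← balancing-move k x with changed x y in c
    ... | zero  = subst (Balanced k) (changed≡0⇒≡ y≤x c) baly
    ... | suc _ = contradiction (Equivalence.from (IH y (S-move k x y∈)) baly) (P⇒N-moves k x isP y∈)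
      where
      y∈ : y ∈ moves k x
      y∈ = ∈-moves⁺ k y≤x (subst (1 ≤_) (sym c) (s≤s z≤n)) (subst (_≤ k) (sym c) few)

  RemotenessFormula : Vec ℕ n → Set
  RemotenessFormula x = IsP k x → remoteness k x * suc k ≡ 2 * S x

  remoteness-upper : ∀ (x ys : Vec ℕ n) → IsP k x → ys ∈ moves k x →
                     remoteness k x ≡ suc (remoteness k ys) →
                     (∀ y → S y < S x → RemotenessFormula y) →
                     remoteness k x * suc k ≤ 2 * S x
  remoteness-upper x ys isP ys∈ Rx≡ IH
    with z , z∈ , isPz , Rys≡ ← N⇒P-move k ys (P⇒N-moves k x isP ys∈)
    with z≤ys , _ ← ∈-moves⁻ k ys z∈
    with ys≤x , _ ← ∈-moves⁻ k x ys∈ = begin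
      remoteness k x * suc k              ≡⟨ cong (_* suc k) (trans Rx≡ (cong suc Rys≡)) ⟩
      suc (suc (remoteness k z)) * suc k  ≡⟨ two-more (suc k) (remoteness k z) (S z) (IH z Sz<Sx isPz) ⟩
      2 * (S z + suc k)                   ≤⟨ *-monoʳ-≤ 2 Sz+k<Sx ⟩
      2 * S x                             ∎
    where
    open ≤-Reasoning
    Sz<Sx = <-trans (S-move k ys z∈) (S-move k x ys∈)
    z≤x = ≤ᵥ-trans z≤ys ys≤x
    Sz+k<Sx : S z + suc k ≤ S x
    Sz+k<Sx = ≤-trans (+-monoʳ-≤ (S z) (balanced-far k z≤x (Equivalence.to (IsP⇔Balanced x) isP)
                                                           (Equivalence.to (IsP⇔Balanced z) isPz) Sz<Sx))
                      (S-changed z≤x)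

  remoteness-lower : ∀ (x y₀ ys : Vec ℕ n) → IsP k x → Delays k x y₀ → y₀ ∈ moves k x →
                     remoteness k x ≡ suc (remoteness k ys) → remoteness k y₀ ≤ remoteness k ys →
                     (∀ y → S y < S x → RemotenessFormula y) →
                     2 * S x ≤ remoteness k x * suc k
  remoteness-lower x y₀ ys isP (_ , _ , far) y₀∈ Rx≡ Ry₀≤ IH
    with z , z∈ , isPz , Ry₀≡ ← N⇒P-move k y₀ (P⇒N-moves k x isP y₀∈)
    with z≤y₀ , _ , few ← ∈-moves⁻ k y₀ z∈ = begin
      2 * S x                             ≤⟨ *-monoʳ-≤ 2 (far z≤y₀ few (Equivalence.to (IsP⇔Balanced z) isPz)) ⟩
      2 * (S z + suc k)                   ≡⟨ two-more (suc k) (remoteness k z) (S z) (IH z Sz<Sx isPz) ⟨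
      suc (suc (remoteness k z)) * suc k  ≡⟨ cong (λ r → suc r * suc k) Ry₀≡ ⟨
      suc (remoteness k y₀) * suc k       ≤⟨ *-monoˡ-≤ (suc k) (s≤s Ry₀≤) ⟩
      suc (remoteness k ys) * suc k       ≡⟨ cong (_* suc k) Rx≡ ⟨
      remoteness k x * suc k              ∎
    where
    open ≤-Reasoning
    Sz<Sx = <-trans (S-move k y₀ z∈) (S-move k x y₀∈)

  remoteness-formula : 0 < k → ∀ x → RemotenessFormula x
  remoteness-formula 0<k = S-induction _ step
    where
    step : ∀ x → (∀ y → S y < S x → RemotenessFormula y) → RemotenessFormula x
    step x IH isP with S x ≟ 0
    ... | yes Sx≡0 = trans (cong (_* suc k) (remF-terminal k (S x) x Sx≡0)) (cong (2 *_) (sym Sx≡0))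
    ... | no Sx≢0
      with y₀ , delays ← delaying-move k x (Equivalence.to (IsP⇔Balanced x) isP) (n≢0⇒n>0 Sx≢0)
      with y₀∈ ← delays⇒move k 0<k delays
      with ys , ys∈ , Rx≡ , Ry₀≤ ← P⇒max-move k x isP y₀∈ =
      ≤-antisym (remoteness-upper x ys isP ys∈ Rx≡ IH) (remoteness-lower x y₀ ys isP delays y₀∈ Rx≡ Ry₀≤ IH)

mainTheorem1 : (n k : ℕ) → 0 < k → k ≤ n → (x : Vec ℕ n) →
    IsP k x → remoteness k x * suc k ≡ 2 * S x
mainTheorem1 n k 0<k _ = remoteness-formula k 0<k
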